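{- Let $C_{n_1}$ be a cycle on $n_1\ge 3$ vertices, and let $G$ be obtained by attaching a path to every vertex of the cycle: for each vertex $v$ of $C_{n_1}$, take a new path $P_v$ with at least one edge (the paths being pairwise vertex-disjoint and disjoint from the cycle, of arbitrary lengths) and identify one end vertex of $P_v$ with $v$. Then $G$ is an AR-graph.
   Context: All graphs are finite, simple and undirected; $\mathbb{N}=\{1,2,3,\dots\}$. Let $f:E(G)\to\mathbb{N}$ be an injective edge labeling of a graph $G$. A vertex $v$ is an AR-vertex (under $f$) if, whenever $x_1,\dots,x_k$ are the labels of the $k$ edges incident on $v$, the $2^k$ sums $\sum_{i\in S}x_i$ over all subsets $S\subseteq\{1,\dots,k\}$ are pairwise distinct. An injective labeling $f$ is an AR-labeling if every vertex is an AR-vertex under $f$. A graph $G$ with $m$ edges is an AR-graph if it has an AR-labeling $f:E(G)\to\{1,2,\dots,m\}$. -}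

module Defs where

open import Data.Nat using (ℕ; zero; suc; _+_; _∸_; _≤_)
open import Data.Bool using (Bool; true; false; if_then_else_)
open import Data.Fin using (Fin; zero; suc)
open import Data.Fin.Subset using (Subset)
open import Data.Vec using (Vec; _∷_; [])
open import Data.List using (List; []; _∷_; _++_; map; upTo; length; lookup; [_])
open import Data.Product using (_×_; _,_; proj₁; proj₂)
open import Data.Sum using (_⊎_)
open import Function.Definitions using (Injective)
open import Relation.Binary.PropositionalEquality using (_≡_)

-- A (finite, simple) graph is given by its list of edges; vertices are
-- natural numbers, edge number e (a Fin (length E)) joins the two
-- components of  lookup E e.  (Vertices incident to no edge are irrelevant
-- for the AR property.)
EdgeList : Set
EdgeList = List (ℕ × ℕ)

IncidentTo : (E : EdgeList) → ℕ → Fin (length E) → Set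
IncidentTo E v e = v ≡ proj₁ (lookup E e) ⊎ v ≡ proj₂ (lookup E e)

subsetSum : ∀ {m} → Subset m → (Fin m → ℕ) → ℕ
subsetSum {zero}  []      f = 0
subsetSum {suc m} (b ∷ S) f = (if b then f zero else 0) + subsetSum S (λ i → f (suc i))

_⊆Inc_ : ∀ {E : EdgeList} → Subset (length E) → ℕ → Set
_⊆Inc_ {E} S v = ∀ (e : Fin (length E)) → Data.Vec.lookup S e ≡ true → IncidentTo E v e

IsARVertex : (E : EdgeList) → (Fin (length E) → ℕ) → ℕ → Set
IsARVertex E f v = ∀ (S T : Subset (length E)) → _⊆Inc_ {E} S v → _⊆Inc_ {E} T v →
  subsetSum S f ≡ subsetSum T f → S ≡ T

IsARLabeling : (E : EdgeList) → (Fin (length E) → ℕ) → Set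
IsARLabeling E f =
  Injective _≡_ _≡_ f
  × (∀ e → 1 ≤ f e × f e ≤ length E)
  × (∀ v → IsARVertex E f v)

IsARGraph : EdgeList → Set
IsARGraph E = Data.Product.Σ (Fin (length E) → ℕ) (IsARLabeling E)

cycleEdges : ℕ → EdgeList
cycleEdges n = map (λ i → i , suc i) (upTo (n ∸ 1)) ++ [ (n ∸ 1 , 0) ]

pathEdges : ℕ → ℕ → ℕ → EdgeList
pathEdges v s zero    = []
pathEdges v s (suc l) = (v , s) ∷ pathEdges s (suc s) l

allPaths : ℕ → ℕ → List ℕ → EdgeList
allPaths i off []       = []
allPaths i off (l ∷ ls) = pathEdges i off l ++ allPaths (suc i) (off + l) ls

-- the graph: cycle C_n (n = length ls) with a path of ls[i] edges
-- attached at cycle vertex i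
cycleWithPaths : List ℕ → EdgeList
cycleWithPaths ls = cycleEdges (length ls) ++ allPaths 0 (length ls) ls

module Submission where

-- Number the cycle edges 0, …, n-1 in cyclic order and the path edges by their far end vertex,
-- and give edge q the label L+1+q if q < n and q-n+1 otherwise, where L is the total path length.
-- A path vertex then sees two distinct labels, and two distinct positive labels are always AR.
-- A cycle vertex d sees three labels x < y < z: the first edge of its path gets x ≤ L, below
-- the two cycle labels y < z. Three positive labels are AR unless x + y = z; here z = y + 1 and
-- x ≥ 2 when d > 0, while for d = 0 we have x = 1, y = L+1, z = L+n and n ≥ 3.

open import Defs
open import Data.Nat using (ℕ; zero; suc; _+_; _∸_; _≤_; _<_; z≤n; s≤s; _≟_; _<?_)
open import Data.Nat.Properties
open import Data.Nat.ListAction using (sum)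
open import Data.Bool using (Bool; true; false; if_then_else_)
open import Data.Fin using (Fin; toℕ)
import Data.Fin as Fin
open import Data.Fin.Properties using (toℕ<n; toℕ-injective)
open import Data.Vec using (Vec; []; _∷_)
import Data.Vec as Vec
open import Data.List using (List; []; _∷_; _++_; map; upTo; applyUpTo; length; lookup; take)
open import Data.List.Properties using (length-++; length-map; length-upTo)
open import Data.List.Relation.Unary.All using (All; []; _∷_)
import Data.List.Relation.Unary.All as All
open import Data.List.Relation.Unary.AllPairs using ([]; _∷_)
open import Data.List.Relation.Unary.Any using (here; there)
open import Data.List.Relation.Unary.Unique.Propositional using (Unique)
open import Data.List.Membership.DecPropositional _≟_ using (_∈_; _∉_; _∈?_)
open import Data.Product using (Σ; _×_; _,_; proj₁; proj₂)
import Data.Product as Product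
open import Data.Sum using (_⊎_; inj₁; inj₂)
open import Data.Empty using (⊥-elim)
open import Function using (_∘_; case_of_)
open import Relation.Nullary using (yes; no)
open import Relation.Binary.PropositionalEquality
open import Algebra.Properties.CommutativeSemigroup +-commutativeSemigroup using (x∙yz≈y∙xz)

-- An out-of-range index is never a member.
member : ∀ {m} → Vec Bool m → ℕ → Bool
member []      q       = false
member (b ∷ S) zero    = b
member (b ∷ S) (suc q) = member S q

remove : ∀ {m} → Vec Bool m → ℕ → Vec Bool m
remove []      q       = []
remove (b ∷ S) zero    = false ∷ S
remove (b ∷ S) (suc q) = b ∷ remove S q

member-remove-≡ : ∀ {m} (S : Vec Bool m) q → member (remove S q) q ≡ false
member-remove-≡ []      q       = refl
member-remove-≡ (b ∷ S) zero    = refl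
member-remove-≡ (b ∷ S) (suc q) = member-remove-≡ S q

member-remove-≢ : ∀ {m} (S : Vec Bool m) {q r} → q ≢ r → member (remove S q) r ≡ member S r
member-remove-≢ []      q≢r = refl
member-remove-≢ (b ∷ S) {zero}  {zero}  q≢r = ⊥-elim (q≢r refl)
member-remove-≢ (b ∷ S) {zero}  {suc r} q≢r = refl
member-remove-≢ (b ∷ S) {suc q} {zero}  q≢r = refl
member-remove-≢ (b ∷ S) {suc q} {suc r} q≢r = member-remove-≢ S (q≢r ∘ cong suc)

SupportedIn : ∀ {m} → Vec Bool m → List ℕ → Set
SupportedIn S qs = ∀ q → member S q ≡ true → q ∈ qs

weightedSum : (ℕ → Bool) → (ℕ → ℕ) → List ℕ → ℕ
weightedSum s g qs = sum (map (λ q → if s q then g q else 0) qs)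

weightedSum-cong : ∀ {s t} g qs → All (λ q → s q ≡ t q) qs → weightedSum s g qs ≡ weightedSum t g qs
weightedSum-cong g []       []         = refl
weightedSum-cong g (q ∷ qs) (sq≡tq ∷ eqs) =
  cong₂ (λ b → (if b then g q else 0) +_) sq≡tq (weightedSum-cong g qs eqs)

subsetSum-remove : ∀ {m} (S : Vec Bool m) g q →
  subsetSum S (λ e → g (toℕ e)) ≡ (if member S q then g q else 0) + subsetSum (remove S q) (λ e → g (toℕ e))
subsetSum-remove []      g q       = refl
subsetSum-remove (b ∷ S) g zero    = refl
subsetSum-remove (b ∷ S) g (suc q) =
  trans (cong ((if b then g 0 else 0) +_) (subsetSum-remove S (λ i → g (suc i)) q))
        (x∙yz≈y∙xz (if b then g 0 else 0) (if member S q then g (suc q) else 0) _)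

subsetSum-empty : ∀ {m} (S : Vec Bool m) g → SupportedIn S [] → subsetSum S (λ e → g (toℕ e)) ≡ 0
subsetSum-empty []          g S⊆[] = refl
subsetSum-empty (true ∷ S)  g S⊆[] with () ← S⊆[] 0 refl
subsetSum-empty (false ∷ S) g S⊆[] = subsetSum-empty S (λ i → g (suc i)) (λ q m → case S⊆[] (suc q) m of λ ())

subsetSum≡weightedSum : ∀ {m} (S : Vec Bool m) g {qs} → Unique qs → SupportedIn S qs →
  subsetSum S (λ e → g (toℕ e)) ≡ weightedSum (member S) g qs
subsetSum≡weightedSum S g {[]}     _              S⊆qs = subsetSum-empty S g S⊆qs
subsetSum≡weightedSum S g {q ∷ qs} (q∉qs ∷ uniq) S⊆qs = begin
  subsetSum S _                                                ≡⟨ subsetSum-remove S g q ⟩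
  (if member S q then g q else 0) + subsetSum (remove S q) _   ≡⟨ cong (_ +_) (subsetSum≡weightedSum (remove S q) g uniq S∖q⊆qs) ⟩
  (if member S q then g q else 0) + weightedSum (member (remove S q)) g qs
    ≡⟨ cong (_ +_) (weightedSum-cong g qs (All.map (member-remove-≢ S) q∉qs)) ⟩
  weightedSum (member S) g (q ∷ qs)                            ∎
  where
  open ≡-Reasoning
  S∖q⊆qs : SupportedIn (remove S q) qs
  S∖q⊆qs r r∈ with q ≟ r
  ... | yes refl with () ← trans (sym (member-remove-≡ S q)) r∈
  ... | no q≢r with S⊆qs r (trans (sym (member-remove-≢ S q≢r)) r∈)
  ...   | here r≡q   = ⊥-elim (q≢r (sym r≡q))
  ...   | there r∈qs = r∈qs

member-outside : ∀ {m} (S : Vec Bool m) {qs q} → SupportedIn S qs → q ∉ qs → member S q ≡ false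
member-outside S {q = q} S⊆qs q∉qs with member S q in eq
... | true  = ⊥-elim (q∉qs (S⊆qs q eq))
... | false = refl

member-extensional : ∀ {m} (S T : Vec Bool m) → (∀ q → member S q ≡ member T q) → S ≡ T
member-extensional []      []      eq = refl
member-extensional (b ∷ S) (c ∷ T) eq = cong₂ _∷_ (eq 0) (member-extensional S T (λ q → eq (suc q)))

≡-if-agree-on-support : ∀ {m} (S T : Vec Bool m) {qs} → SupportedIn S qs → SupportedIn T qs →
  All (λ q → member S q ≡ member T q) qs → S ≡ T
≡-if-agree-on-support S T {qs} S⊆qs T⊆qs agree = member-extensional S T agreeAll
  where
  agreeAll : ∀ q → member S q ≡ member T q
  agreeAll q with q ∈? qs
  ... | yes q∈qs = All.lookup agree q∈qs
  ... | no  q∉qs = trans (member-outside S S⊆qs q∉qs) (sym (member-outside T T⊆qs q∉qs))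

Dissociated : (ℕ → ℕ) → List ℕ → Set
Dissociated g qs = ∀ s t → weightedSum s g qs ≡ weightedSum t g qs → All (λ q → s q ≡ t q) qs

dissociated-[] : ∀ {g} → Dissociated g []
dissociated-[] s t _ = []

dissociated-∷ : ∀ {g qs c} → Dissociated g qs →
  (∀ s t → g c + weightedSum s g qs ≢ weightedSum t g qs) → Dissociated g (c ∷ qs)
dissociated-∷ {g} {qs} {c} dis gap s t eq with s c in sc | t c in tc
... | true  | true  = trans sc (sym tc) ∷ dis s t (+-cancelˡ-≡ (g c) _ _ eq)
... | false | false = trans sc (sym tc) ∷ dis s t eq
... | true  | false = ⊥-elim (gap s t eq)
... | false | true  = ⊥-elim (gap t s (sym eq))

weightedSum-≤ : ∀ s g qs → weightedSum s g qs ≤ sum (map g qs)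
weightedSum-≤ s g []       = z≤n
weightedSum-≤ s g (q ∷ qs) with s q
... | true  = +-monoʳ-≤ (g q) (weightedSum-≤ s g qs)
... | false = ≤-trans (weightedSum-≤ s g qs) (m≤n+m _ (g q))

dissociated-∷-large : ∀ {g qs c} → Dissociated g qs → sum (map g qs) < g c → Dissociated g (c ∷ qs)
dissociated-∷-large {g} {qs} {c} dis large = dissociated-∷ dis λ s t eq →
  <⇒≱ (<-≤-trans large (m≤m+n (g c) _)) (≤-trans (≤-reflexive eq) (weightedSum-≤ t g qs))

dissociated-pair : ∀ {g b a} → 0 < g a → g a < g b → Dissociated g (b ∷ a ∷ [])
dissociated-pair {g} {b} {a} 0<ga ga<gb =
  dissociated-∷-large {g} (dissociated-∷-large {g} (dissociated-[] {g}) 0<ga) (≤-<-trans (≤-reflexive (+-identityʳ (g a))) ga<gb)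

dissociated-triple : ∀ {g c b a} → 0 < g a → g a < g b → g b < g c → g a + g b ≢ g c →
  Dissociated g (c ∷ b ∷ a ∷ [])
dissociated-triple {g} {c} {b} {a} 0<ga ga<gb gb<gc ga+gb≢gc =
  dissociated-∷ (dissociated-pair {g} 0<ga ga<gb) gap
  where
  ga<gc : g a < g c
  ga<gc = <-trans ga<gb gb<gc
  below : ∀ {A B} → B < g c → g c + A ≢ B
  below B<gc eq = <⇒≢ (<-≤-trans B<gc (m≤m+n (g c) _)) (sym eq)
  -- Every subset sum of {g a, g b} other than g a + g b is below g c, and g c + g a already exceeds it.
  gap : ∀ s t → g c + weightedSum s g (b ∷ a ∷ []) ≢ weightedSum t g (b ∷ a ∷ [])
  gap s t with s b
  ... | true = λ eq → <⇒≢ (begin-strict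
    weightedSum t g (b ∷ a ∷ []) ≤⟨ weightedSum-≤ t g (b ∷ a ∷ []) ⟩
    g b + (g a + 0)              ≡⟨ cong (g b +_) (+-identityʳ (g a)) ⟩
    g b + g a                    <⟨ +-monoʳ-< (g b) ga<gc ⟩
    g b + g c                    ≡⟨ +-comm (g b) (g c) ⟩
    g c + g b                    ≤⟨ +-monoʳ-≤ (g c) (m≤m+n (g b) _) ⟩
    g c + (g b + _)              ∎) (sym eq)
    where open ≤-Reasoning
  ... | false with t b
  ... | false = below (≤-<-trans (weightedSum-≤ t g (a ∷ [])) (subst (_< g c) (sym (+-identityʳ (g a))) ga<gc))
  ... | true with s a | t a
  ... | _     | false = below (subst (_< g c) (sym (+-identityʳ (g b))) gb<gc)
  ... | true  | true  = λ eq → <⇒≢ gb<gc (sym (+-cancelʳ-≡ (g a + 0) (g c) (g b) eq))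
  ... | false | true  = λ eq → ga+gb≢gc (begin
    g a + g b       ≡⟨ +-comm (g a) (g b) ⟩
    g b + g a       ≡⟨ cong (g b +_) (sym (+-identityʳ (g a))) ⟩
    g b + (g a + 0) ≡⟨ sym eq ⟩
    g c + 0         ≡⟨ +-identityʳ (g c) ⟩
    g c             ∎)
    where open ≡-Reasoning

member-true : ∀ {m} (S : Vec Bool m) {q} → member S q ≡ true → Σ (Fin m) λ e → toℕ e ≡ q × Vec.lookup S e ≡ true
member-true (b ∷ S) {zero}  b≡true = Fin.zero , refl , b≡true
member-true (b ∷ S) {suc q} q∈S with member-true S q∈S
... | e , refl , e∈S = Fin.suc e , refl , e∈S

isARVertex-dissociated : ∀ (E : EdgeList) g v {qs} → Unique qs → Dissociated g qs →
  (∀ e → IncidentTo E v e → toℕ e ∈ qs) → IsARVertex E (λ e → g (toℕ e)) v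
isARVertex-dissociated E g v {qs} uniq dis incident S T S⊆v T⊆v eq =
  ≡-if-agree-on-support S T (supported S S⊆v) (supported T T⊆v) (dis (member S) (member T) (begin
    weightedSum (member S) g qs ≡⟨ sym (subsetSum≡weightedSum S g uniq (supported S S⊆v)) ⟩
    subsetSum S _               ≡⟨ eq ⟩
    subsetSum T _               ≡⟨ subsetSum≡weightedSum T g uniq (supported T T⊆v) ⟩
    weightedSum (member T) g qs ∎))
  where
  open ≡-Reasoning
  supported : ∀ S → _⊆Inc_ {E} S v → SupportedIn S qs
  supported S S⊆v q q∈S with member-true S q∈S
  ... | e , refl , e∈S = incident e (S⊆v e e∈S)

labels-differ : ∀ {g : ℕ → ℕ} {p q} → g q < g p → p ≢ q
labels-differ gq<gp refl = <-irrefl refl gq<gp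

isARVertex-pair : ∀ (E : EdgeList) g v {b a} → 0 < g a → g a < g b →
  (∀ e → IncidentTo E v e → toℕ e ∈ b ∷ a ∷ []) → IsARVertex E (λ e → g (toℕ e)) v
isARVertex-pair E g v 0<ga ga<gb =
  isARVertex-dissociated E g v ((labels-differ {g} ga<gb ∷ []) ∷ [] ∷ []) (dissociated-pair {g} 0<ga ga<gb)

isARVertex-triple : ∀ (E : EdgeList) g v {c b a} → 0 < g a → g a < g b → g b < g c → g a + g b ≢ g c →
  (∀ e → IncidentTo E v e → toℕ e ∈ c ∷ b ∷ a ∷ []) → IsARVertex E (λ e → g (toℕ e)) v
isARVertex-triple E g v 0<ga ga<gb gb<gc ga+gb≢gc = isARVertex-dissociated E g v
  ((labels-differ {g} gb<gc ∷ labels-differ {g} (<-trans ga<gb gb<gc) ∷ []) ∷ (labels-differ {g} ga<gb ∷ []) ∷ [] ∷ [])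
  (dissociated-triple {g} 0<ga ga<gb gb<gc ga+gb≢gc)

nth : {A : Set} → A → List A → ℕ → A
nth d []       q       = d
nth d (x ∷ xs) zero    = x
nth d (x ∷ xs) (suc q) = nth d xs q

lookup≡nth : ∀ {A} (d : A) xs (i : Fin (length xs)) → lookup xs i ≡ nth d xs (toℕ i)
lookup≡nth d (x ∷ xs) Fin.zero    = refl
lookup≡nth d (x ∷ xs) (Fin.suc i) = lookup≡nth d xs i

nth-++ˡ : ∀ {A} (d : A) xs ys {q} → q < length xs → nth d (xs ++ ys) q ≡ nth d xs q
nth-++ˡ d (x ∷ xs) ys {zero}  _       = refl
nth-++ˡ d (x ∷ xs) ys {suc q} (s≤s q<) = nth-++ˡ d xs ys q<

nth-++ʳ : ∀ {A} (d : A) xs ys {m} k → length xs ≡ m → nth d (xs ++ ys) (m + k) ≡ nth d ys k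
nth-++ʳ d []       ys k refl = refl
nth-++ʳ d (x ∷ xs) ys k refl = nth-++ʳ d xs ys k refl

nth-map-applyUpTo : ∀ {A} (d : A) (h : ℕ → A) f {m q} → q < m → nth d (map h (applyUpTo f m)) q ≡ h (f q)
nth-map-applyUpTo d h f {suc m} {zero}  _        = refl
nth-map-applyUpTo d h f {suc m} {suc q} (s≤s q<) = nth-map-applyUpTo d h (λ i → f (suc i)) q<

length-pathEdges : ∀ v s l → length (pathEdges v s l) ≡ l
length-pathEdges v s zero    = refl
length-pathEdges v s (suc l) = cong suc (length-pathEdges s (suc s) l)

length-allPaths : ∀ i off ls → length (allPaths i off ls) ≡ sum ls
length-allPaths i off []       = refl
length-allPaths i off (l ∷ ls) =
  trans (length-++ (pathEdges i off l)) (cong₂ _+_ (length-pathEdges i off l) (length-allPaths (suc i) (off + l) ls))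

cyclePrefix : ℕ → EdgeList
cyclePrefix n = map (λ i → i , suc i) (upTo (n ∸ 1))

length-cyclePrefix : ∀ n → length (cyclePrefix n) ≡ n ∸ 1
length-cyclePrefix n = trans (length-map _ (upTo (n ∸ 1))) (length-upTo (n ∸ 1))

length-cycleEdges : ∀ {n} → 1 ≤ n → length (cycleEdges n) ≡ n
length-cycleEdges {n} 1≤n =
  trans (length-++ (cyclePrefix n)) (trans (cong (_+ 1) (length-cyclePrefix n)) (m∸n+n≡m 1≤n))

nth-cycleEdges-step : ∀ d {n q} → suc q < n → nth d (cycleEdges n) q ≡ (q , suc q)
nth-cycleEdges-step d {n} {q} sq<n = begin
  nth d (cyclePrefix n ++ _) q ≡⟨ nth-++ˡ d (cyclePrefix n) _ (subst (q <_) (sym (length-cyclePrefix n)) q<n∸1) ⟩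
  nth d (cyclePrefix n) q      ≡⟨ nth-map-applyUpTo d _ (λ i → i) q<n∸1 ⟩
  (q , suc q)                  ∎
  where
  open ≡-Reasoning
  q<n∸1 : q < n ∸ 1
  q<n∸1 = ∸-monoˡ-< sq<n (s≤s z≤n)

nth-cycleEdges-close : ∀ d n → nth d (cycleEdges n) (n ∸ 1) ≡ (n ∸ 1 , 0)
nth-cycleEdges-close d n =
  trans (cong (nth d (cycleEdges n)) (sym (+-identityʳ (n ∸ 1)))) (nth-++ʳ d (cyclePrefix n) _ 0 (length-cyclePrefix n))

nth-pathSteps : ∀ d u {l k} → k < l → nth d (pathEdges u (suc u) l) k ≡ (u + k , suc (u + k))
nth-pathSteps d u {suc l} {zero}  _        = cong (λ x → x , suc x) (sym (+-identityʳ u))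
nth-pathSteps d u {suc l} {suc k} (s≤s k<) =
  trans (nth-pathSteps d (suc u) k<) (cong (λ x → x , suc x) (sym (+-suc u k)))

data PathEdge (i off : ℕ) (ls : List ℕ) : ℕ × ℕ → Set where
  start : ∀ {d} → d < length ls → PathEdge i off ls (i + d , off + sum (take d ls))
  step  : ∀ {u} → off ≤ u → PathEdge i off ls (u , suc u)

PathEdge-shift : ∀ {i off l ls p} → PathEdge (suc i) (off + l) ls p → PathEdge i off (l ∷ ls) p
PathEdge-shift {i} {off} {l} {ls} (start {d} d<) =
  subst (PathEdge i off (l ∷ ls)) (cong₂ _,_ (+-suc i d) (sym (+-assoc off l _))) (start (s≤s d<))
PathEdge-shift (step off+l≤u) = step (≤-trans (m≤m+n _ _) off+l≤u)

nth-pathEdges : ∀ d i off {l ls k} → k < l →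
  PathEdge i off (l ∷ ls) (nth d (pathEdges i off l) k) × proj₂ (nth d (pathEdges i off l) k) ≡ off + k
nth-pathEdges d i off {suc l} {ls} {zero} _ =
  subst (PathEdge i off (suc l ∷ ls)) (cong₂ _,_ (+-identityʳ i) (+-identityʳ off)) (start (s≤s z≤n)) ,
  sym (+-identityʳ off)
nth-pathEdges d i off {suc l} {ls} {suc k} (s≤s k<) rewrite nth-pathSteps d off k< =
  step (m≤m+n off k) , sym (+-suc off k)

nth-allPaths : ∀ d i off ls {k} → k < sum ls →
  PathEdge i off ls (nth d (allPaths i off ls) k) × proj₂ (nth d (allPaths i off ls) k) ≡ off + k
nth-allPaths d i off (l ∷ ls) {k} k< with k <? l
... | yes k<l rewrite nth-++ˡ d (pathEdges i off l) (allPaths (suc i) (off + l) ls)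
                        (subst (k <_) (sym (length-pathEdges i off l)) k<l) = nth-pathEdges d i off k<l
... | no k≮l with m≤n⇒∃[o]m+o≡n (≮⇒≥ k≮l)
...   | k′ , refl rewrite nth-++ʳ d (pathEdges i off l) (allPaths (suc i) (off + l) ls) k′ (length-pathEdges i off l) =
  Product.map PathEdge-shift (λ e → trans e (+-assoc off l k′))
    (nth-allPaths d (suc i) (off + l) ls (+-cancelˡ-< l k′ (sum ls) k<))

_touches_ : ℕ → ℕ × ℕ → Set
v touches p = v ≡ proj₁ p ⊎ v ≡ proj₂ p

module CycleWithPaths (ls : List ℕ) (1≤n : 1 ≤ length ls) where

  n : ℕ
  n = length ls

  L : ℕ
  L = sum ls

  E : EdgeList
  E = cycleWithPaths ls

  edge : ℕ → ℕ × ℕ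
  edge = nth (0 , 0) E

  pathStart : ℕ → ℕ
  pathStart d = n + sum (take d ls)

  n≤pathStart : ∀ d → n ≤ pathStart d
  n≤pathStart d = m≤m+n n _

  -- EdgeAt q p: edge number q of E is p.
  data EdgeAt : ℕ → ℕ × ℕ → Set where
    cycle-step  : ∀ {q} → suc q < n → EdgeAt q (q , suc q)
    cycle-close : EdgeAt (n ∸ 1) (n ∸ 1 , 0)
    path-start  : ∀ {d} → d < n → EdgeAt (pathStart d) (d , pathStart d)
    path-step   : ∀ {u} → n ≤ u → EdgeAt (suc u) (u , suc u)

  length-E : length E ≡ n + L
  length-E = trans (length-++ (cycleEdges n)) (cong₂ _+_ (length-cycleEdges 1≤n) (length-allPaths 0 n ls))

  cycleEdgeAt : ∀ {q} → q < n → EdgeAt q (nth (0 , 0) (cycleEdges n) q)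
  cycleEdgeAt {q} q<n with suc q <? n
  ... | yes sq<n rewrite nth-cycleEdges-step (0 , 0) sq<n = cycle-step sq<n
  ... | no sq≮n with ≤-antisym (∸-monoˡ-≤ 1 q<n) (∸-monoˡ-≤ 1 (≮⇒≥ sq≮n))
  ...   | refl rewrite nth-cycleEdges-close (0 , 0) n = cycle-close

  pathEdgeAt : ∀ {q p} → PathEdge 0 n ls p × proj₂ p ≡ q → EdgeAt q p
  pathEdgeAt (start d<n , refl) = path-start d<n
  pathEdgeAt (step n≤u  , refl) = path-step n≤u

  edgeAt : ∀ {q} → q < n + L → EdgeAt q (edge q)
  edgeAt {q} q< with q <? n
  ... | yes q<n rewrite nth-++ˡ (0 , 0) (cycleEdges n) (allPaths 0 n ls)
                          (subst (q <_) (sym (length-cycleEdges 1≤n)) q<n) = cycleEdgeAt q<n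
  ... | no q≮n with m≤n⇒∃[o]m+o≡n (≮⇒≥ q≮n)
  ...   | k , refl rewrite nth-++ʳ (0 , 0) (cycleEdges n) (allPaths 0 n ls) k (length-cycleEdges 1≤n) =
    pathEdgeAt (nth-allPaths (0 , 0) 0 n ls (+-cancelˡ-< n k L q<))

  n∸1<n : n ∸ 1 < n
  n∸1<n = ∸-monoʳ-< (s≤s z≤n) 1≤n

  pathVertex-edges : ∀ {v q p} → n ≤ v → EdgeAt q p → v touches p → q ∈ suc v ∷ v ∷ []
  pathVertex-edges n≤v (cycle-step sq<n) (inj₁ refl) = ⊥-elim (<⇒≱ (<-trans (n<1+n _) sq<n) n≤v)
  pathVertex-edges n≤v (cycle-step sq<n) (inj₂ refl) = ⊥-elim (<⇒≱ sq<n n≤v)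
  pathVertex-edges n≤v cycle-close       (inj₁ refl) = ⊥-elim (<⇒≱ n∸1<n n≤v)
  pathVertex-edges n≤v cycle-close       (inj₂ refl) = ⊥-elim (<⇒≱ 1≤n n≤v)
  pathVertex-edges n≤v (path-start d<n)  (inj₁ refl) = ⊥-elim (<⇒≱ d<n n≤v)
  pathVertex-edges n≤v (path-start d<n)  (inj₂ refl) = there (here refl)
  pathVertex-edges n≤v (path-step n≤u)   (inj₁ refl) = here refl
  pathVertex-edges n≤v (path-step n≤u)   (inj₂ refl) = there (here refl)

  vertex0-edges : ∀ {q p} → EdgeAt q p → 0 touches p → q ∈ n ∸ 1 ∷ 0 ∷ pathStart 0 ∷ []
  vertex0-edges (cycle-step _)       (inj₁ refl) = there (here refl)
  vertex0-edges cycle-close          _           = here refl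
  vertex0-edges (path-start _)       (inj₁ refl) = there (there (here refl))
  vertex0-edges (path-start {d} _)   (inj₂ 0≡)   = ⊥-elim (<⇒≱ 1≤n (subst (n ≤_) (sym 0≡) (n≤pathStart d)))
  vertex0-edges (path-step n≤u)      (inj₁ refl) = ⊥-elim (<⇒≱ 1≤n n≤u)

  cycleVertex-edges : ∀ {w q p} → suc w < n → EdgeAt q p → suc w touches p →
    q ∈ suc w ∷ w ∷ pathStart (suc w) ∷ []
  cycleVertex-edges sw<n (cycle-step _)     (inj₁ refl) = here refl
  cycleVertex-edges sw<n (cycle-step _)     (inj₂ refl) = there (here refl)
  cycleVertex-edges sw<n cycle-close        (inj₁ eq)   = here (sym eq)
  cycleVertex-edges sw<n (path-start _)     (inj₁ refl) = there (there (here refl))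
  cycleVertex-edges sw<n (path-start {d} _) (inj₂ eq)   = ⊥-elim (<⇒≱ sw<n (subst (n ≤_) (sym eq) (n≤pathStart d)))
  cycleVertex-edges sw<n (path-step n≤u)    (inj₁ refl) = ⊥-elim (<⇒≱ sw<n n≤u)
  cycleVertex-edges sw<n (path-step n≤u)    (inj₂ refl) = ⊥-elim (<⇒≱ sw<n (≤-trans n≤u (n≤1+n _)))

  toℕ-< : (e : Fin (length E)) → toℕ e < n + L
  toℕ-< e = subst (toℕ e <_) length-E (toℕ<n e)

  incident-edges : ∀ {v qs} → (∀ {q p} → EdgeAt q p → v touches p → q ∈ qs) →
    ∀ e → IncidentTo E v e → toℕ e ∈ qs
  incident-edges {v} edges-at e incident =
    edges-at (edgeAt (toℕ-< e)) (subst (v touches_) (lookup≡nth (0 , 0) E e) incident)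

sum-take-< : ∀ {ls} → All (1 ≤_) ls → ∀ {d} → d < length ls → sum (take d ls) < sum ls
sum-take-< (1≤l ∷ _)        {zero}  _        = ≤-trans 1≤l (m≤m+n _ _)
sum-take-< {l ∷ _} (_ ∷ ps) {suc d} (s≤s d<) = +-monoʳ-< l (sum-take-< ps d<)

sum-take-suc-positive : ∀ {ls} → All (1 ≤_) ls → 0 < length ls → ∀ d → 0 < sum (take (suc d) ls)
sum-take-suc-positive (1≤l ∷ _) _ d = ≤-trans 1≤l (m≤m+n _ _)

module CycleWithPathsLabeling (ls : List ℕ) (3≤n : 3 ≤ length ls) (positive : All (1 ≤_) ls) where

  open CycleWithPaths ls (≤-trans (s≤s z≤n) 3≤n)

  label : ℕ → ℕ
  label q with q <? n
  ... | yes _ = suc (L + q)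
  ... | no  _ = suc (q ∸ n)

  label-cycle : ∀ {q} → q < n → label q ≡ suc (L + q)
  label-cycle {q} q<n with q <? n
  ... | yes _   = refl
  ... | no  q≮n = ⊥-elim (q≮n q<n)

  label-path : ∀ {q} → n ≤ q → label q ≡ suc (q ∸ n)
  label-path {q} n≤q with q <? n
  ... | yes q<n = ⊥-elim (<⇒≱ q<n n≤q)
  ... | no  _   = refl

  label-pathStart : ∀ d → label (pathStart d) ≡ suc (sum (take d ls))
  label-pathStart d = trans (label-path (n≤pathStart d)) (cong suc (m+n∸m≡n n _))

  pathOffset-< : ∀ {q} → n ≤ q → q < n + L → q ∸ n < L
  pathOffset-< {q} n≤q q< = subst (q ∸ n <_) (m+n∸m≡n n L) (∸-monoˡ-< q< n≤q)

  label-injective : ∀ {q q′} → q < n + L → q′ < n + L → label q ≡ label q′ → q ≡ q′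
  label-injective {q} {q′} q< q′< eq with q <? n | q′ <? n
  ... | yes _   | yes _    = +-cancelˡ-≡ L q q′ (suc-injective eq)
  ... | no  q≮n | no  q′≮n = ∸-cancelʳ-≡ (≮⇒≥ q≮n) (≮⇒≥ q′≮n) (suc-injective eq)
  ... | yes _   | no  q′≮n =
    ⊥-elim (<⇒≱ (pathOffset-< (≮⇒≥ q′≮n) q′<) (≤-trans (m≤m+n L q) (≤-reflexive (suc-injective eq))))
  ... | no  q≮n | yes _    =
    ⊥-elim (<⇒≱ (pathOffset-< (≮⇒≥ q≮n) q<) (≤-trans (m≤m+n L q′) (≤-reflexive (suc-injective (sym eq)))))

  label-bounded : ∀ {q} → q < n + L → 1 ≤ label q × label q ≤ n + L
  label-bounded {q} q< with q <? n
  ... | yes q<n = s≤s z≤n , ≤-trans (≤-reflexive (sym (+-suc L q))) (≤-trans (+-monoʳ-≤ L q<n) (≤-reflexive (+-comm L n)))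
  ... | no  q≮n = s≤s z≤n , ≤-trans (pathOffset-< (≮⇒≥ q≮n) q<) (m≤n+m L n)

  cycle-label-< : ∀ {p q} → p < q → q < n → label p < label q
  cycle-label-< {p} {q} p<q q<n =
    subst₂ _<_ (sym (label-cycle (<-trans p<q q<n))) (sym (label-cycle q<n)) (s≤s (+-monoʳ-< L p<q))

  pathStart-label-< : ∀ {d q} → d < n → q < n → label (pathStart d) < label q
  pathStart-label-< {d} {q} d<n q<n =
    subst₂ _<_ (sym (label-pathStart d)) (sym (label-cycle q<n)) (s≤s (<-≤-trans (sum-take-< positive d<n) (m≤m+n L q)))

  labeling : Fin (length E) → ℕ
  labeling e = label (toℕ e)

  pathVertex-isAR : ∀ {v} → n ≤ v → IsARVertex E labeling v
  pathVertex-isAR {v} n≤v = isARVertex-pair E label v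
    (subst (0 <_) (sym (label-path n≤v)) (s≤s z≤n)) lv<lsv (incident-edges (pathVertex-edges n≤v))
    where
    open ≤-Reasoning
    lv<lsv : label v < label (suc v)
    lv<lsv = begin-strict
      label v           ≡⟨ label-path n≤v ⟩
      suc (v ∸ n)       <⟨ n<1+n _ ⟩
      suc (suc (v ∸ n)) ≡⟨ cong suc (sym (+-∸-assoc 1 n≤v)) ⟩
      suc (suc v ∸ n)   ≡⟨ sym (label-path (≤-trans n≤v (n≤1+n v))) ⟩
      label (suc v)     ∎

  vertex0-isAR : IsARVertex E labeling 0
  vertex0-isAR = isARVertex-triple E label 0 {n ∸ 1} {0} {pathStart 0}
    (subst (0 <_) (sym (label-pathStart 0)) (s≤s z≤n)) (pathStart-label-< 0<n 0<n) (cycle-label-< 0<n∸1 n∸1<n)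
    sum≢ (incident-edges vertex0-edges)
    where
    open ≡-Reasoning
    0<n : 0 < n
    0<n = ≤-trans (s≤s z≤n) 3≤n
    1<n∸1 : 1 < n ∸ 1
    1<n∸1 = ∸-monoˡ-≤ 1 3≤n
    0<n∸1 : 0 < n ∸ 1
    0<n∸1 = <-trans (s≤s z≤n) 1<n∸1
    sum≢ : label (pathStart 0) + label 0 ≢ label (n ∸ 1)
    sum≢ eq = <⇒≢ (+-monoʳ-< L 1<n∸1) (begin
      L + 1         ≡⟨ +-suc L 0 ⟩
      suc (L + 0)   ≡⟨ suc-injective (trans (sym (cong₂ _+_ (label-pathStart 0) (label-cycle 0<n))) (trans eq (label-cycle n∸1<n))) ⟩
      L + (n ∸ 1)   ∎)

  cycleVertex-isAR : ∀ {w} → suc w < n → IsARVertex E labeling (suc w)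
  cycleVertex-isAR {w} sw<n = isARVertex-triple E label (suc w) {suc w} {w} {pathStart (suc w)}
    (subst (0 <_) (sym (label-pathStart (suc w))) (s≤s z≤n)) (pathStart-label-< sw<n w<n) (cycle-label-< (n<1+n w) sw<n)
    sum≢ (incident-edges (cycleVertex-edges sw<n))
    where
    w<n : w < n
    w<n = <-trans (n<1+n w) sw<n
    s : ℕ
    s = sum (take (suc w) ls)
    sum≢ : label (pathStart (suc w)) + label w ≢ label (suc w)
    sum≢ eq = <⇒≢ (begin-strict
      label (suc w)                          ≡⟨ label-cycle sw<n ⟩
      suc (L + suc w)                        ≡⟨ cong suc (+-suc L w) ⟩
      1 + suc (L + w)                        <⟨ +-monoˡ-< (suc (L + w)) (s≤s (sum-take-suc-positive positive (<-trans (s≤s z≤n) sw<n) w)) ⟩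
      suc s + suc (L + w)                    ≡⟨ sym (cong₂ _+_ (label-pathStart (suc w)) (label-cycle w<n)) ⟩
      label (pathStart (suc w)) + label w    ∎) (sym eq)
      where open ≤-Reasoning

  every-vertex-isAR : ∀ v → IsARVertex E labeling v
  every-vertex-isAR v with v <? n
  every-vertex-isAR zero    | yes _    = vertex0-isAR
  every-vertex-isAR (suc w) | yes sw<n = cycleVertex-isAR sw<n
  every-vertex-isAR v       | no  v≮n  = pathVertex-isAR (≮⇒≥ v≮n)

  isARLabeling : IsARLabeling E labeling
  isARLabeling =
    (λ {e} {e′} eq → toℕ-injective (label-injective (toℕ-< e) (toℕ-< e′) eq)) ,
    (λ e → Product.map₂ (subst (labeling e ≤_) (sym length-E)) (label-bounded (toℕ-< e))) ,
    every-vertex-isAR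

mainTheorem19 : (ls : List ℕ) → 3 ≤ length ls → All (1 ≤_) ls →
    IsARGraph (cycleWithPaths ls)
mainTheorem19 ls 3≤n positive = labeling , isARLabeling
  where open CycleWithPathsLabeling ls 3≤n positive
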